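{- Let $(\mathcal{T}_r)_{r\in\mathbb{Z}}$ be any generalized Tribonacci sequence. Then for every integer $r$ and every nonnegative integer $k$, \[ 103\sum_{j=0}^{k}56^j\mathcal{T}_{r+16+17j}=56^{k+1}\mathcal{T}_{r+17k+17}-\mathcal{T}_r, \] \[ 56\sum_{j=0}^{k}(-1)^j103^j\mathcal{T}_{r+17+16j}=\mathcal{T}_r-(-103)^{k+1}\mathcal{T}_{r+16k+16}, \] and \[ \sum_{j=0}^{k}103^{k-j}56^j\mathcal{T}_{r-16+j}=-103^{k+1}\mathcal{T}_r+56^{k+1}\mathcal{T}_{r+k+1}. \]
   Context: A generalized Tribonacci sequence is any sequence $(\mathcal{T}_r)_{r\in\mathbb{Z}}$ of complex numbers with $\mathcal{T}_r=\mathcal{T}_{r-1}+\mathcal{T}_{r-2}+\mathcal{T}_{r-3}$ for all $r\in\mathbb{Z}$. -}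

module Defs where

open import Level using (_⊔_)
open import Algebra.Bundles using (CommutativeRing)
open import Data.Nat as ℕ using (ℕ; zero; suc)
open import Data.Integer as ℤ using (ℤ; +_)

-- Definitions over an arbitrary commutative ring R (the paper uses ℂ).
module Tri {c ℓ} (R : CommutativeRing c ℓ) where
  open CommutativeRing R

  nat : ℕ → Carrier
  nat zero    = 0#
  nat (suc n) = 1# + nat n

  pow : Carrier → ℕ → Carrier
  pow x zero    = 1#
  pow x (suc n) = x * pow x n

  sumTo : ℕ → (ℕ → Carrier) → Carrier
  sumTo zero    f = f 0
  sumTo (suc k) f = sumTo k f + f (suc k)

  IsTribonacci : (ℤ → Carrier) → Set ℓ
  IsTribonacci T = ∀ (r : ℤ) →
    T r ≈ T (r ℤ.- + 1) + T (r ℤ.- + 2) + T (r ℤ.- + 3)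

{-# OPTIONS --safe #-}
-- Writing T(s+n) = aₙ T(s) + bₙ T(s+1) + cₙ T(s+2) with ℕ-coefficient triples
-- (aₙ, bₙ, cₙ), a direct computation of these triples gives
-- 56 T(s+17) = T(s) + 103 T(s+16) for every s; equivalently, x³ − x² − x − 1
-- divides 56x¹⁷ − 103x¹⁶ − 1.  Each of the three sums telescopes against this
-- relation.
module Submission where

open import Defs
open import Algebra.Bundles using (CommutativeMonoid; CommutativeRing)
open import Data.Integer as ℤ using (ℤ; +_)
import Data.Integer.Properties as ℤP
open import Data.Nat as ℕ using (ℕ; zero; suc; _∸_; _≤_; z≤n)
import Data.Nat.Properties as ℕP
open import Data.Product using (_×_; _,_)
open import Relation.Binary.PropositionalEquality as P using (_≡_)

+-pos-assoc : ∀ r m n → r ℤ.+ + m ℤ.+ + n ≡ r ℤ.+ + (m ℕ.+ n)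
+-pos-assoc r m n = P.trans (ℤP.+-assoc r (+ m) (+ n)) (P.cong (λ i → r ℤ.+ i) (P.sym (ℤP.pos-+ m n)))

-+-pos-cancel : ∀ r m → r ℤ.- + m ℤ.+ + m ≡ r
-+-pos-cancel r m = P.trans (ℤP.+-assoc r (ℤ.- + m) (+ m))
  (P.trans (P.cong (λ i → r ℤ.+ i) (ℤP.+-inverseˡ (+ m))) (ℤP.+-identityʳ r))

module TribonacciCoefficients {c ℓ} (M : CommutativeMonoid c ℓ) where
  open CommutativeMonoid M
    renaming ( _∙_ to _+_; ∙-cong to +-cong; ∙-congʳ to +-congʳ; ∙-congˡ to +-congˡ
             ; identityˡ to +-identityˡ; identityʳ to +-identityʳ)
  open import Algebra.Properties.CommutativeMonoid.Mult M renaming (_×_ to _·_)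
  open import Algebra.Properties.CommutativeSemigroup commutativeSemigroup using (interchange)
  open import Relation.Binary.Reasoning.Setoid setoid

  Coeffs : Set
  Coeffs = ℕ × ℕ × ℕ

  infixl 6 _⊕_
  infixr 7 _⊙_

  _⊕_ : Coeffs → Coeffs → Coeffs
  (a , b , c) ⊕ (a′ , b′ , c′) = (a ℕ.+ a′ , b ℕ.+ b′ , c ℕ.+ c′)

  _⊙_ : ℕ → Coeffs → Coeffs
  m ⊙ (a , b , c) = (m ℕ.* a , m ℕ.* b , m ℕ.* c)

  tribCoeffs : ℕ → Coeffs
  tribCoeffs 0 = (1 , 0 , 0)
  tribCoeffs 1 = (0 , 1 , 0)
  tribCoeffs 2 = (0 , 0 , 1)
  tribCoeffs (suc (suc (suc n))) = tribCoeffs (suc (suc n)) ⊕ tribCoeffs (suc n) ⊕ tribCoeffs n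

  56⊙tribCoeffs17≡tribCoeffs0⊕103⊙tribCoeffs16 :
    56 ⊙ tribCoeffs 17 ≡ tribCoeffs 0 ⊕ 103 ⊙ tribCoeffs 16
  56⊙tribCoeffs17≡tribCoeffs0⊕103⊙tribCoeffs16 = P.refl

  module Evaluation (U : ℕ → Carrier) where
    ⟦_⟧ : Coeffs → Carrier
    ⟦ a , b , c ⟧ = a · U 0 + b · U 1 + c · U 2

    ⟦⊕⟧ : ∀ p q → ⟦ p ⊕ q ⟧ ≈ ⟦ p ⟧ + ⟦ q ⟧
    ⟦⊕⟧ (a , b , c) (a′ , b′ , c′) =
      trans (+-cong (+-cong (×-homo-+ (U 0) a a′) (×-homo-+ (U 1) b b′)) (×-homo-+ (U 2) c c′))
        (trans (+-congʳ (interchange _ _ _ _)) (interchange _ _ _ _))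

    ⟦⊙⟧ : ∀ m p → ⟦ m ⊙ p ⟧ ≈ m · ⟦ p ⟧
    ⟦⊙⟧ m (a , b , c) =
      trans (+-cong (+-cong (sym (×-assocˡ (U 0) m a)) (sym (×-assocˡ (U 1) m b))) (sym (×-assocˡ (U 2) m c)))
        (sym (trans (×-distrib-+ _ _ m) (+-congʳ (×-distrib-+ _ _ m))))

    module _ (rec : ∀ n → U (3 ℕ.+ n) ≈ U (2 ℕ.+ n) + U (1 ℕ.+ n) + U n) where
      U≈⟦tribCoeffs⟧ : ∀ n → U n ≈ ⟦ tribCoeffs n ⟧
      U≈⟦tribCoeffs⟧ 0 = sym (trans (+-identityʳ _) (trans (+-identityʳ _) (+-identityʳ _)))
      U≈⟦tribCoeffs⟧ 1 = sym (trans (+-identityʳ _) (trans (+-identityˡ _) (+-identityʳ _)))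
      U≈⟦tribCoeffs⟧ 2 = sym (trans (+-cong (+-identityˡ _) (+-identityʳ _)) (+-identityˡ _))
      U≈⟦tribCoeffs⟧ (suc (suc (suc n))) = begin
        U (3 ℕ.+ n)                      ≈⟨ rec n ⟩
        U (2 ℕ.+ n) + U (1 ℕ.+ n) + U n
          ≈⟨ +-cong (+-cong (U≈⟦tribCoeffs⟧ (suc (suc n))) (U≈⟦tribCoeffs⟧ (suc n)))
                    (U≈⟦tribCoeffs⟧ n) ⟩
        ⟦ x ⟧ + ⟦ y ⟧ + ⟦ z ⟧            ≈⟨ +-congʳ (⟦⊕⟧ x y) ⟨
        ⟦ x ⊕ y ⟧ + ⟦ z ⟧                ≈⟨ ⟦⊕⟧ (x ⊕ y) z ⟨
        ⟦ x ⊕ y ⊕ z ⟧                    ∎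
        where
        x y z : Coeffs
        x = tribCoeffs (2 ℕ.+ n)
        y = tribCoeffs (1 ℕ.+ n)
        z = tribCoeffs n

      56·U₁₇≈U₀+103·U₁₆ : 56 · U 17 ≈ U 0 + 103 · U 16
      56·U₁₇≈U₀+103·U₁₆ = begin
        56 · U 17                                 ≈⟨ ×-congʳ 56 (U≈⟦tribCoeffs⟧ 17) ⟩
        56 · ⟦ tribCoeffs 17 ⟧                    ≈⟨ ⟦⊙⟧ 56 (tribCoeffs 17) ⟨
        ⟦ 56 ⊙ tribCoeffs 17 ⟧
          ≡⟨ P.cong ⟦_⟧ 56⊙tribCoeffs17≡tribCoeffs0⊕103⊙tribCoeffs16 ⟩
        ⟦ tribCoeffs 0 ⊕ 103 ⊙ tribCoeffs 16 ⟧     ≈⟨ ⟦⊕⟧ (tribCoeffs 0) (103 ⊙ tribCoeffs 16) ⟩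
        ⟦ tribCoeffs 0 ⟧ + ⟦ 103 ⊙ tribCoeffs 16 ⟧ ≈⟨ +-congˡ (⟦⊙⟧ 103 (tribCoeffs 16)) ⟩
        ⟦ tribCoeffs 0 ⟧ + 103 · ⟦ tribCoeffs 16 ⟧
          ≈⟨ +-cong (U≈⟦tribCoeffs⟧ 0) (×-congʳ 103 (U≈⟦tribCoeffs⟧ 16)) ⟨
        U 0 + 103 · U 16                          ∎

module _ {ℓ₁ ℓ₂} (R : CommutativeRing ℓ₁ ℓ₂) where
  open CommutativeRing R
  open Tri R
  open import Algebra.Properties.Ring ring using (-1*x≈-x; -‿distribˡ-*; xyx⁻¹≈y)
  open import Algebra.Properties.CommutativeSemigroup *-commutativeSemigroup
    using (interchange; x∙yz≈y∙xz; x∙yz≈xz∙y; xy∙z≈y∙xz)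
  open import Algebra.Properties.Monoid.Mult +-monoid using () renaming (_×_ to _·_)
  open TribonacciCoefficients +-commutativeMonoid using (module Evaluation)
  open import Relation.Binary.Reasoning.Setoid setoid

  x≈y+z⇒z≈x-y : ∀ {x y z} → x ≈ y + z → z ≈ x - y
  x≈y+z⇒z≈x-y {y = y} {z} x≈y+z = sym (trans (+-congʳ x≈y+z) (xyx⁻¹≈y y z))

  nat*≈· : ∀ n x → nat n * x ≈ n · x
  nat*≈· zero    x = zeroˡ x
  nat*≈· (suc n) x = trans (distribʳ x 1# (nat n)) (+-cong (*-identityˡ x) (nat*≈· n x))

  pow[-1]*pow≈pow[-] : ∀ x n → pow (- 1#) n * pow x n ≈ pow (- x) n
  pow[-1]*pow≈pow[-] x zero    = *-identityˡ 1#
  pow[-1]*pow≈pow[-] x (suc n) =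
    trans (interchange (- 1#) _ x _) (*-cong (-1*x≈-x x) (pow[-1]*pow≈pow[-] x n))

  sumTo-cong : ∀ k {f g : ℕ → Carrier} → (∀ j → f j ≈ g j) → sumTo k f ≈ sumTo k g
  sumTo-cong zero    f≈g = f≈g 0
  sumTo-cong (suc k) f≈g = +-cong (sumTo-cong k f≈g) (f≈g (suc k))

  *-distribˡ-sumTo : ∀ a k (f : ℕ → Carrier) → a * sumTo k f ≈ sumTo k (λ j → a * f j)
  *-distribˡ-sumTo a zero    f = refl
  *-distribˡ-sumTo a (suc k) f = trans (distribˡ a _ _) (+-congʳ (*-distribˡ-sumTo a k f))

  sumTo-telescope : ∀ k (g t : ℕ → Carrier) → (∀ j → j ≤ k → t (suc j) ≈ t j + g j) →
                    t (suc k) ≈ t 0 + sumTo k g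
  sumTo-telescope zero    g t step = step 0 z≤n
  sumTo-telescope (suc k) g t step = begin
    t (2 ℕ.+ k)                    ≈⟨ step (suc k) ℕP.≤-refl ⟩
    t (suc k) + g (suc k)
      ≈⟨ +-congʳ (sumTo-telescope k g t (λ j j≤k → step j (ℕP.m≤n⇒m≤1+n j≤k))) ⟩
    t 0 + sumTo k g + g (suc k)    ≈⟨ +-assoc _ _ _ ⟩
    t 0 + sumTo (suc k) g          ∎

  sumTo-telescope′ : ∀ k (g t : ℕ → Carrier) → (∀ j → t j ≈ t (suc j) + g j) →
                     t 0 ≈ t (suc k) + sumTo k g
  sumTo-telescope′ zero    g t step = step 0
  sumTo-telescope′ (suc k) g t step = begin
    t 0                                ≈⟨ sumTo-telescope′ k g t step ⟩
    t (suc k) + sumTo k g              ≈⟨ +-congʳ (step (suc k)) ⟩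
    t (2 ℕ.+ k) + g (suc k) + sumTo k g ≈⟨ +-assoc _ _ _ ⟩
    t (2 ℕ.+ k) + (g (suc k) + sumTo k g) ≈⟨ +-congˡ (+-comm _ _) ⟩
    t (2 ℕ.+ k) + sumTo (suc k) g      ∎

  -x+[y+x]≈y : ∀ x y → - x + (y + x) ≈ y
  -x+[y+x]≈y x y = trans (+-comm (- x) _) (trans (+-congʳ (+-comm y x)) (xyx⁻¹≈y x y))

  module LinearRelation (a b : Carrier) (p : ℕ) (V : ℕ → Carrier)
           (rel : ∀ n → a * V (suc p ℕ.+ n) ≈ V n + b * V (p ℕ.+ n)) where

    V-cong : ∀ {m n} → m ≡ n → V m ≈ V n
    V-cong m≡n = reflexive (P.cong V m≡n)

    strided-sum : ∀ k → b * sumTo k (λ j → pow a j * V (p ℕ.+ suc p ℕ.* j))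
                      ≈ pow a (suc k) * V (suc p ℕ.* k ℕ.+ suc p) - V 0
    strided-sum k = x≈y+z⇒z≈x-y (begin
      pow a (suc k) * V (suc p ℕ.* k ℕ.+ suc p)
        ≈⟨ *-congˡ (V-cong (P.trans (ℕP.+-comm _ (suc p)) (P.sym (ℕP.*-suc (suc p) k)))) ⟩
      t (suc k)                         ≈⟨ sumTo-telescope k (λ j → b * f j) t (λ j _ → step j) ⟩
      t 0 + sumTo k (λ j → b * f j)
        ≈⟨ +-cong (trans (*-identityˡ _) (V-cong (ℕP.*-zeroʳ (suc p)))) (sym (*-distribˡ-sumTo b k f)) ⟩
      V 0 + b * sumTo k f               ∎)
      where
      f t : ℕ → Carrier
      f j = pow a j * V (p ℕ.+ suc p ℕ.* j)
      t j = pow a j * V (suc p ℕ.* j)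

      step : ∀ j → t (suc j) ≈ t j + b * f j
      step j = begin
        a * pow a j * V (suc p ℕ.* suc j)                        ≈⟨ *-congˡ (V-cong (ℕP.*-suc (suc p) j)) ⟩
        a * pow a j * V (suc p ℕ.+ suc p ℕ.* j)                  ≈⟨ xy∙z≈y∙xz _ _ _ ⟩
        pow a j * (a * V (suc p ℕ.+ suc p ℕ.* j))                ≈⟨ *-congˡ (rel _) ⟩
        pow a j * (V (suc p ℕ.* j) + b * V (p ℕ.+ suc p ℕ.* j))  ≈⟨ distribˡ _ _ _ ⟩
        t j + pow a j * (b * V (p ℕ.+ suc p ℕ.* j))              ≈⟨ +-congˡ (x∙yz≈y∙xz _ _ _) ⟩
        t j + b * f j                                            ∎

    alternating-sum : ∀ k → a * sumTo k (λ j → pow (- 1#) j * pow b j * V (suc p ℕ.+ p ℕ.* j))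
                          ≈ V 0 - pow (- b) (suc k) * V (p ℕ.* k ℕ.+ p)
    alternating-sum k = x≈y+z⇒z≈x-y (begin
      V 0                                  ≈⟨ trans (*-identityˡ _) (V-cong (ℕP.*-zeroʳ p)) ⟨
      t 0                                  ≈⟨ sumTo-telescope′ k (λ j → a * f j) t step ⟩
      t (suc k) + sumTo k (λ j → a * f j)
        ≈⟨ +-cong (*-congˡ (V-cong (P.trans (ℕP.*-suc p k) (ℕP.+-comm p _))))
                  (sym (*-distribˡ-sumTo a k f)) ⟩
      pow (- b) (suc k) * V (p ℕ.* k ℕ.+ p) + a * sumTo k f ∎)
      where
      f t : ℕ → Carrier
      f j = pow (- 1#) j * pow b j * V (suc p ℕ.+ p ℕ.* j)
      t j = pow (- b) j * V (p ℕ.* j)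

      step : ∀ j → t j ≈ t (suc j) + a * f j
      step j = sym (begin
        t (suc j) + a * f j                        ≈⟨ +-cong t-suc a*f ⟩
        - (c * (b * Y)) + (t j + c * (b * Y))      ≈⟨ -x+[y+x]≈y _ _ ⟩
        t j                                        ∎)
        where
        c Y : Carrier
        c = pow (- b) j
        Y = V (p ℕ.+ p ℕ.* j)

        t-suc : t (suc j) ≈ - (c * (b * Y))
        t-suc = begin
          - b * c * V (p ℕ.* suc j)  ≈⟨ *-cong (sym (-‿distribˡ-* b c)) (V-cong (ℕP.*-suc p j)) ⟩
          - (b * c) * Y              ≈⟨ -‿distribˡ-* _ Y ⟨
          - (b * c * Y)              ≈⟨ -‿cong (xy∙z≈y∙xz b c Y) ⟩
          - (c * (b * Y))            ∎

        a*f : a * f j ≈ t j + c * (b * Y)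
        a*f = begin
          a * f j                                         ≈⟨ x∙yz≈y∙xz _ _ _ ⟩
          pow (- 1#) j * pow b j * (a * V (suc p ℕ.+ p ℕ.* j)) ≈⟨ *-cong (pow[-1]*pow≈pow[-] b j) (rel _) ⟩
          c * (V (p ℕ.* j) + b * Y)                       ≈⟨ distribˡ _ _ _ ⟩
          t j + c * (b * Y)                               ∎

    convolution-sum : ∀ k → sumTo k (λ j → pow b (k ∸ j) * pow a j * V j)
                          ≈ - (pow b (suc k) * V p) + pow a (suc k) * V (p ℕ.+ suc k)
    convolution-sum k = begin
      sumTo k g          ≈⟨ x≈y+z⇒z≈x-y (sumTo-telescope k g t step) ⟩
      t (suc k) - t 0    ≈⟨ +-comm _ _ ⟩
      - t 0 + t (suc k)  ≈⟨ +-cong (-‿cong t-zero) t-suc ⟩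
      - (pow b (suc k) * V p) + pow a (suc k) * V (p ℕ.+ suc k) ∎
      where
      g t : ℕ → Carrier
      g j = pow b (k ∸ j) * pow a j * V j
      t j = pow b (suc k ∸ j) * pow a j * V (p ℕ.+ j)

      t-zero : t 0 ≈ pow b (suc k) * V p
      t-zero = *-cong (*-identityʳ _) (V-cong (ℕP.+-identityʳ p))

      t-suc : t (suc k) ≈ pow a (suc k) * V (p ℕ.+ suc k)
      t-suc = *-congʳ (trans (*-congʳ (reflexive (P.cong (pow b) (ℕP.n∸n≡0 k)))) (*-identityˡ _))

      step : ∀ j → j ≤ k → t (suc j) ≈ t j + g j
      step j j≤k = begin
        c * (a * d) * V (p ℕ.+ suc j)        ≈⟨ *-congˡ (V-cong (ℕP.+-suc p j)) ⟩
        c * (a * d) * V (suc p ℕ.+ j)        ≈⟨ trans (*-congʳ (x∙yz≈xz∙y c a d)) (*-assoc _ a _) ⟩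
        c * d * (a * V (suc p ℕ.+ j))        ≈⟨ *-congˡ (rel j) ⟩
        c * d * (V j + b * Y)                ≈⟨ distribˡ _ _ _ ⟩
        c * d * V j + c * d * (b * Y)        ≈⟨ +-comm _ _ ⟩
        c * d * (b * Y) + g j
          ≈⟨ +-congʳ (trans (sym (*-assoc _ b Y)) (*-congʳ (trans (*-comm _ b) (sym (*-assoc b c d))))) ⟩
        b * c * d * Y + g j
          ≈⟨ +-congʳ (*-congʳ (*-congʳ (reflexive (P.cong (pow b) (P.sym (ℕP.+-∸-assoc 1 j≤k)))))) ⟩
        t j + g j                            ∎
        where
        c d Y : Carrier
        c = pow b (k ∸ j)
        d = pow a j
        Y = V (p ℕ.+ j)

  module _ (T : ℤ → Carrier) (isTribonacci : IsTribonacci T) where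
    T-cong : ∀ {r s} → r ≡ s → T r ≈ T s
    T-cong r≡s = reflexive (P.cong T r≡s)

    shift : ℤ → ℕ → Carrier
    shift r n = T (r ℤ.+ + n)

    shift-recurrence : ∀ r n → shift r (3 ℕ.+ n) ≈ shift r (2 ℕ.+ n) + shift r (1 ℕ.+ n) + shift r n
    shift-recurrence r n = trans (isTribonacci _)
      (+-cong (+-cong (T-cong (ℤP.+-assoc r _ _)) (T-cong (ℤP.+-assoc r _ _))) (T-cong (ℤP.+-assoc r _ _)))

    56*shift≈shift+103*shift : ∀ r n →
      nat 56 * shift r (17 ℕ.+ n) ≈ shift r n + nat 103 * shift r (16 ℕ.+ n)
    56*shift≈shift+103*shift r n = begin
      nat 56 * shift r (17 ℕ.+ n)          ≈⟨ nat*≈· 56 _ ⟩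
      56 · shift r (17 ℕ.+ n)
        ≈⟨ Evaluation.56·U₁₇≈U₀+103·U₁₆ (λ m → shift r (m ℕ.+ n)) (λ m → shift-recurrence r (m ℕ.+ n)) ⟩
      shift r n + 103 · shift r (16 ℕ.+ n) ≈⟨ +-congˡ (nat*≈· 103 _) ⟨
      shift r n + nat 103 * shift r (16 ℕ.+ n) ∎

    module Shifted (r : ℤ) = LinearRelation (nat 56) (nat 103) 16 (shift r) (56*shift≈shift+103*shift r)

    tribonacci-strided-sum : ∀ r k →
      nat 103 * sumTo k (λ j → pow (nat 56) j * T (r ℤ.+ + 16 ℤ.+ + (17 ℕ.* j)))
        ≈ pow (nat 56) (suc k) * T (r ℤ.+ + (17 ℕ.* k) ℤ.+ + 17) - T r
    tribonacci-strided-sum r k =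
      trans (*-congˡ (sumTo-cong k λ j → *-congˡ (T-cong (+-pos-assoc r 16 (17 ℕ.* j)))))
        (trans (Shifted.strided-sum r k)
          (+-cong (*-congˡ (T-cong (P.sym (+-pos-assoc r (17 ℕ.* k) 17))))
                  (-‿cong (T-cong (ℤP.+-identityʳ r)))))

    tribonacci-alternating-sum : ∀ r k →
      nat 56 * sumTo k (λ j → pow (- 1#) j * pow (nat 103) j * T (r ℤ.+ + 17 ℤ.+ + (16 ℕ.* j)))
        ≈ T r - pow (- nat 103) (suc k) * T (r ℤ.+ + (16 ℕ.* k) ℤ.+ + 16)
    tribonacci-alternating-sum r k =
      trans (*-congˡ (sumTo-cong k λ j → *-congˡ (T-cong (+-pos-assoc r 17 (16 ℕ.* j)))))
        (trans (Shifted.alternating-sum r k)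
          (+-cong (T-cong (ℤP.+-identityʳ r))
                  (-‿cong (*-congˡ (T-cong (P.sym (+-pos-assoc r (16 ℕ.* k) 16)))))))

    tribonacci-convolution-sum : ∀ r k →
      sumTo k (λ j → pow (nat 103) (k ∸ j) * pow (nat 56) j * T (r ℤ.- + 16 ℤ.+ + j))
        ≈ - (pow (nat 103) (suc k) * T r) + pow (nat 56) (suc k) * T (r ℤ.+ + (suc k))
    tribonacci-convolution-sum r k =
      trans (Shifted.convolution-sum (r ℤ.- + 16) k)
        (+-cong (-‿cong (*-congˡ (T-cong (-+-pos-cancel r 16))))
                (*-congˡ (T-cong (P.trans (P.sym (+-pos-assoc (r ℤ.- + 16) 16 (suc k)))
                                          (P.cong (λ i → i ℤ.+ + suc k) (-+-pos-cancel r 16))))))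

theorem7 : ∀ {c ℓ} (R : CommutativeRing c ℓ) →
    let open CommutativeRing R in
    let open Tri R in
    (T : ℤ → Carrier) → IsTribonacci T → (r : ℤ) (k : ℕ) →
      (nat 103 * sumTo k (λ j → pow (nat 56) j * T (r ℤ.+ + 16 ℤ.+ + (17 ℕ.* j)))
        ≈ pow (nat 56) (suc k) * T (r ℤ.+ + (17 ℕ.* k) ℤ.+ + 17) - T r)
      × (nat 56 * sumTo k (λ j → pow (- 1#) j * pow (nat 103) j * T (r ℤ.+ + 17 ℤ.+ + (16 ℕ.* j)))
        ≈ T r - pow (- nat 103) (suc k) * T (r ℤ.+ + (16 ℕ.* k) ℤ.+ + 16))
      × (sumTo k (λ j → pow (nat 103) (k ∸ j) * pow (nat 56) j * T (r ℤ.- + 16 ℤ.+ + j))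
        ≈ - (pow (nat 103) (suc k) * T r) + pow (nat 56) (suc k) * T (r ℤ.+ + (suc k)))
theorem7 R T isTribonacci r k =
    tribonacci-strided-sum R T isTribonacci r k
  , tribonacci-alternating-sum R T isTribonacci r k
  , tribonacci-convolution-sum R T isTribonacci r k
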